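{- Let $\lambda$ be a partition and let $x_1,\ldots,x_{\ell(\lambda)},y_1,\ldots,y_{\lambda_1}$ be commuting variables. Then \[ \Big[\sum_{p=1}^{\ell(\lambda)} x_p\Big]\prod_{\substack{(i,j)\in[\lambda]\\ j\ne 1}}\left(x_{i} + \cdots + x_{\lambda_j'} + y_{j}+ \cdots + y_{\lambda_i}\right) =\sum_{\substack{(r,s) \in \mathcal{C}'[\lambda]\\ s\neq 1}} \Bigg[\prod_{\substack{(i,j) \in [\lambda]\\ i \neq r,\ j \neq 1,s }} \left(x_{i} + \cdots + x_{\lambda_j'} + y_{j}+ \cdots + y_{\lambda_i}\right)\Bigg] \cdot \left[ \prod_{i=1}^{r-1} \left(x_{i+1} + \cdots + x_{r-1} + y_{s}+ \cdots + y_{\lambda_i}\right)\right] \cdot \left[ \prod_{j=1}^{s-1} \left(x_{r}+ \cdots + x_{\lambda_j'} + y_{j+1} + \cdots + y_{s-1}\right)\right]. \]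
   Context: For a partition $\lambda=(\lambda_1\ge\lambda_2\ge\cdots\ge\lambda_\ell>0)$, $\ell(\lambda)=\ell$ is its number of parts, its Young diagram is $[\lambda]=\{(i,j)\in\mathbb{Z}^2: 1\le i\le \ell,\ 1\le j\le\lambda_i\}$ (row index $i$, column index $j$), and the conjugate partition is $\lambda'_j=\max\{i:\lambda_i\ge j\}$. The set $\mathcal{C}'[\lambda]$ of outer corners of $\lambda$ consists of the squares $(i,j)\notin[\lambda]$ with $i,j\ge 1$ such that ($i=1$ or $(i-1,j)\in[\lambda]$) and ($j=1$ or $(i,j-1)\in[\lambda]$). A sum of the form $x_a+\cdots+x_b$ (or $y_a+\cdots+y_b$) with $b<a$ is $0$; an empty product is $1$. -}

module Defs where

open import Level using (Level)
open import Data.Bool using (Bool; true; false; _∧_; _∨_; not; if_then_else_)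
open import Data.Nat using (ℕ; zero; suc; _+_; _∸_; _≤_; _≤ᵇ_; _≡ᵇ_; _⊔_)
open import Data.List using (List; []; _∷_; length; filter; map; concatMap; foldr; upTo)
open import Data.Product using (_×_; _,_; proj₁; proj₂)
open import Relation.Unary using (Pred)
open import Relation.Nullary.Decidable using (Dec; yes; no)
open import Data.Bool using (T)
open import Algebra.Bundles using (CommutativeRing)

data Decreasing : List ℕ → Set where
  dec-[] : Decreasing []
  dec-[x] : ∀ {a} → Decreasing (a ∷ [])
  dec-∷ : ∀ {a b bs} → b ≤ a → Decreasing (b ∷ bs) → Decreasing (a ∷ b ∷ bs)

data AllPositive : List ℕ → Set where
  pos-[] : AllPositive []
  pos-∷ : ∀ {a as} → 1 ≤ a → AllPositive as → AllPositive (a ∷ as)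

IsPartition : List ℕ → Set
IsPartition λs = Decreasing λs × AllPositive λs

len : List ℕ → ℕ
len = length

-- λ_i, 1-indexed; 0 for i = 0 or i > ℓ(λ)
part : List ℕ → ℕ → ℕ
part []       _             = 0
part (a ∷ as) zero          = 0
part (a ∷ as) (suc zero)    = a
part (a ∷ as) (suc (suc i)) = part as (suc i)

-- conjugate: λ'_j = max { i : λ_i ≥ j }  (0 if no such i)
conjFrom : ℕ → List ℕ → ℕ → ℕ
conjFrom k []       j = 0
conjFrom k (a ∷ as) j = if j ≤ᵇ a then k ⊔ conjFrom (suc k) as j else conjFrom (suc k) as j

conj : List ℕ → ℕ → ℕ
conj λs j = conjFrom 1 λs j

inDiagram : List ℕ → ℕ → ℕ → Bool
inDiagram λs i j = (1 ≤ᵇ i) ∧ (i ≤ᵇ len λs) ∧ (1 ≤ᵇ j) ∧ (j ≤ᵇ part λs i)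

-- [a..b] as a list of naturals (empty if b < a)
range : ℕ → ℕ → List ℕ
range a b = map (a +_) (upTo (suc b ∸ a))

box : ℕ → ℕ → ℕ → ℕ → List (ℕ × ℕ)
box a b c d = concatMap (λ i → map (λ j → (i , j)) (range c d)) (range a b)

diagram : List ℕ → List (ℕ × ℕ)
diagram λs = concatMap (λ i → map (λ j → (i , j)) (range 1 (part λs i))) (range 1 (len λs))

filterB : {A : Set} → (A → Bool) → List A → List A
filterB p []       = []
filterB p (x ∷ xs) = if p x then x ∷ filterB p xs else filterB p xs

isOuterCorner : List ℕ → ℕ → ℕ → Bool
isOuterCorner λs i j =
  not (inDiagram λs i j) ∧ (1 ≤ᵇ i) ∧ (1 ≤ᵇ j)
  ∧ ((i ≡ᵇ 1) ∨ inDiagram λs (i ∸ 1) j)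
  ∧ ((j ≡ᵇ 1) ∨ inDiagram λs i (j ∸ 1))

-- C'[λ]: every outer corner lies in [1..ℓ+1] × [1..λ₁+1], so we filter that box
outerCorners : List ℕ → List (ℕ × ℕ)
outerCorners λs =
  filterB (λ c → isOuterCorner λs (proj₁ c) (proj₂ c))
          (box 1 (suc (len λs)) 1 (suc (part λs 1)))


module RingSums {c ℓ : Level} (R : CommutativeRing c ℓ) where
  open CommutativeRing R hiding (_+_; _*_)
  open CommutativeRing R using () renaming (_+_ to _⊕_; _*_ to _⊛_)

  sumL : List Carrier → Carrier
  sumL = foldr _⊕_ 0#

  prodL : List Carrier → Carrier
  prodL = foldr _⊛_ 1#

  rsum : (ℕ → Carrier) → ℕ → ℕ → Carrier
  rsum z a b = sumL (map z (range a b))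

  hookFactor : List ℕ → (ℕ → Carrier) → (ℕ → Carrier) → ℕ × ℕ → Carrier
  hookFactor λs x y (i , j) = rsum x i (conj λs j) ⊕ rsum y j (part λs i)

  LHS : List ℕ → (ℕ → Carrier) → (ℕ → Carrier) → Carrier
  LHS λs x y =
    rsum x 1 (len λs)
    ⊛ prodL (map (hookFactor λs x y)
                 (filterB (λ c → not (proj₂ c ≡ᵇ 1)) (diagram λs)))

  term : List ℕ → (ℕ → Carrier) → (ℕ → Carrier) → ℕ × ℕ → Carrier
  term λs x y (r , s) =
    prodL (map (hookFactor λs x y)
               (filterB (λ c → not (proj₁ c ≡ᵇ r) ∧ not (proj₂ c ≡ᵇ 1) ∧ not (proj₂ c ≡ᵇ s))
                        (diagram λs)))
    ⊛ prodL (map (λ i → rsum x (suc i) (r ∸ 1) ⊕ rsum y s (part λs i)) (range 1 (r ∸ 1)))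
    ⊛ prodL (map (λ j → rsum x r (conj λs j) ⊕ rsum y (suc j) (s ∸ 1)) (range 1 (s ∸ 1)))

  RHS : List ℕ → (ℕ → Carrier) → (ℕ → Carrier) → Carrier
  RHS λs x y =
    sumL (map (term λs x y)
              (filterB (λ c → not (proj₂ c ≡ᵇ 1)) (outerCorners λs)))

module Submission where

-- We argue by induction on the number of rows: λ = b ∷ μ,
-- and removing the first row turns the hooks and corner terms of λ into those of μ with the
-- variables x shifted by one.  The induction carries an auxiliary identity (TopRowIdentity):
-- put a virtual row 0 of length a ≥ μ₁ and variable w on top of μ; then Q(μ) times the "arm"
-- factors of that row equals Q(μ) times its hooks plus the corner terms of μ weighted by its
-- hooks.  At w = x₁, a = b it evaluates the term of the new corner (1, b+1) of λ.

open import Defs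
open import Level using (Level; _⊔_)
open import Algebra.Bundles using (CommutativeRing)
open import Data.Bool using (Bool; true; false; _∧_; _∨_; not; if_then_else_)
open import Data.Nat using (ℕ; zero; suc; _+_; _∸_; _≤_; _<_; _≤ᵇ_; _≡ᵇ_; z≤n; s≤s; _≟_; _≤?_)
open import Data.List using (List; []; _∷_; _++_; map; concat; concatMap; length; iterate; applyUpTo)
open import Data.List.Relation.Unary.All as All using (All; []; _∷_)
open import Data.Product using (_×_; _,_; proj₁; proj₂)
open import Relation.Nullary using (¬_; yes; no; contradiction)

module Lists where
  open import Relation.Binary.PropositionalEquality
  open import Data.Nat.Properties

  private variable
    A B : Set

  filterB-++ : ∀ (p : A → Bool) xs ys → filterB p (xs ++ ys) ≡ filterB p xs ++ filterB p ys
  filterB-++ p []       ys = refl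
  filterB-++ p (x ∷ xs) ys with p x
  ... | true  = cong (x ∷_) (filterB-++ p xs ys)
  ... | false = filterB-++ p xs ys

  filterB-map : ∀ (p : B → Bool) (g : A → B) xs →
                filterB p (map g xs) ≡ map g (filterB (λ c → p (g c)) xs)
  filterB-map p g []       = refl
  filterB-map p g (x ∷ xs) with p (g x)
  ... | true  = cong (g x ∷_) (filterB-map p g xs)
  ... | false = filterB-map p g xs

  filterB-cong : ∀ (p q : A → Bool) {xs} → All (λ c → p c ≡ q c) xs → filterB p xs ≡ filterB q xs
  filterB-cong p q []                   = refl
  filterB-cong p q {x ∷ xs} (px≡qx ∷ es) rewrite px≡qx with q x
  ... | true  = cong (x ∷_) (filterB-cong p q es)
  ... | false = filterB-cong p q es

  filterB-all : ∀ (p : A → Bool) {xs} → All (λ c → p c ≡ true) xs → filterB p xs ≡ xs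
  filterB-all p []                  = refl
  filterB-all p {x ∷ xs} (px ∷ ps) rewrite px = cong (x ∷_) (filterB-all p ps)

  filterB-none : ∀ (p : A → Bool) {xs} → All (λ c → p c ≡ false) xs → filterB p xs ≡ []
  filterB-none p []                  = refl
  filterB-none p {x ∷ xs} (px ∷ ps) rewrite px = filterB-none p ps

  All-filterB : ∀ {ℓ} {P : A → Set ℓ} (p : A → Bool) {xs} → All P xs → All P (filterB p xs)
  All-filterB p [] = []
  All-filterB p {x ∷ xs} (px ∷ ps) with p x
  ... | true  = px ∷ All-filterB p ps
  ... | false = All-filterB p ps

  run-applyUpTo : ∀ n {f g : ℕ → ℕ} {a} → (∀ k → g (f k) ≡ a + k) →
                  map g (applyUpTo f n) ≡ iterate suc a n
  run-applyUpTo zero    eq = refl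
  run-applyUpTo (suc n) {a = a} eq =
    cong₂ _∷_ (trans (eq 0) (+-identityʳ a)) (run-applyUpTo n (λ k → trans (eq (suc k)) (+-suc a k)))

  range-run : ∀ a b → range a b ≡ iterate suc a (suc b ∸ a)
  range-run a b = run-applyUpTo (suc b ∸ a) (λ k → refl)

  run-++ : ∀ a m n → iterate suc a (m + n) ≡ iterate suc a m ++ iterate suc (a + m) n
  run-++ a zero    n = cong (λ t → iterate suc t n) (sym (+-identityʳ a))
  run-++ a (suc m) n = cong (a ∷_) (trans (run-++ (suc a) m n)
    (cong (λ t → iterate suc (suc a) m ++ iterate suc t n) (sym (+-suc a m))))

  run-shift : ∀ a n → map suc (iterate suc a n) ≡ iterate suc (suc a) n
  run-shift a zero    = refl
  run-shift a (suc n) = cong (suc a ∷_) (run-shift (suc a) n)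

  All-run : ∀ {p} {P : ℕ → Set p} a n → (∀ j → a ≤ j → j < a + n → P j) → All P (iterate suc a n)
  All-run a zero    h = []
  All-run a (suc n) h =
    h a ≤-refl (subst (a <_) (sym (+-suc a n)) (s≤s (m≤m+n a n)))
    ∷ All-run (suc a) n (λ j a<j j< → h j (<⇒≤ a<j) (subst (j <_) (sym (+-suc a n)) j<))

  range-split : ∀ a t b → a ≤ suc t → t ≤ b → range a b ≡ range a t ++ range (suc t) b
  range-split a t b a≤1+t t≤b = begin
    range a b                                                  ≡⟨ range-run a b ⟩
    iterate suc a (suc b ∸ a)                                  ≡⟨ cong (iterate suc a) lengths ⟩
    iterate suc a ((suc t ∸ a) + (b ∸ t))                      ≡⟨ run-++ a (suc t ∸ a) (b ∸ t) ⟩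
    iterate suc a (suc t ∸ a) ++ iterate suc (a + (suc t ∸ a)) (b ∸ t)
      ≡⟨ cong (λ u → iterate suc a (suc t ∸ a) ++ iterate suc u (b ∸ t)) (m+[n∸m]≡n a≤1+t) ⟩
    iterate suc a (suc t ∸ a) ++ iterate suc (suc t) (b ∸ t)  ≡⟨ sym (cong₂ _++_ (range-run a t) (range-run (suc t) b)) ⟩
    range a t ++ range (suc t) b                               ∎
    where
    open ≡-Reasoning
    lengths : suc b ∸ a ≡ (suc t ∸ a) + (b ∸ t)
    lengths = trans (cong (λ u → suc u ∸ a) (sym (m+[n∸m]≡n t≤b))) (+-∸-comm (b ∸ t) a≤1+t)

  range-empty : ∀ b → range (suc b) b ≡ []
  range-empty b = trans (range-run (suc b) b) (cong (iterate suc (suc b)) (n∸n≡0 b))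

  range-single : ∀ a → range a a ≡ a ∷ []
  range-single a = trans (range-run a a) (cong (iterate suc a) (m+n∸n≡m 1 a))

  range-uncons : ∀ a b → a ≤ b → range a b ≡ a ∷ range (suc a) b
  range-uncons a b a≤b = trans (range-split a a b (n≤1+n a) a≤b) (cong (_++ range (suc a) b) (range-single a))

  range-unsnoc : ∀ a b → a ≤ suc b → range a (suc b) ≡ range a b ++ suc b ∷ []
  range-unsnoc a b a≤1+b = trans (range-split a b (suc b) a≤1+b (n≤1+n b)) (cong (range a b ++_) (range-single (suc b)))

  range-shift : ∀ a b → range (suc a) (suc b) ≡ map suc (range a b)
  range-shift a b = trans (range-run (suc a) (suc b)) (sym (trans (cong (map suc) (range-run a b)) (run-shift a (suc b ∸ a))))

  range-from-1 : ∀ n → range 1 (suc n) ≡ 1 ∷ map suc (range 1 n)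
  range-from-1 n = trans (range-uncons 1 (suc n) (s≤s z≤n)) (cong (1 ∷_) (range-shift 1 n))

  All-range : ∀ {p} {P : ℕ → Set p} a b → (∀ j → a ≤ j → j ≤ b → P j) → All P (range a b)
  All-range {P = P} a b h = subst (All P) (sym (range-run a b)) (All-run a (suc b ∸ a) (λ j a≤j j< → h j a≤j (bound j a≤j j<)))
    where
    bound : ∀ j → a ≤ j → j < a + (suc b ∸ a) → j ≤ b
    bound j a≤j j< with a ≤? suc b
    ... | yes a≤1+b = ≤-pred (subst (j <_) (m+[n∸m]≡n a≤1+b) j<)
    ... | no  a≰1+b = contradiction a≤j (<⇒≱ (subst (j <_) a+0≡a j<))
      where a+0≡a = trans (cong (a +_) (m≤n⇒m∸n≡0 (<⇒≤ (≰⇒> a≰1+b)))) (+-identityʳ a)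

module Comparisons where
  open import Relation.Binary.PropositionalEquality
  open import Data.Nat.Properties
  open import Data.Bool using (T)
  open import Data.Bool.Properties using (T-≡)
  open import Function.Bundles using (Equivalence)

  private
    ¬T⇒false : ∀ {b} → ¬ T b → b ≡ false
    ¬T⇒false {false} _  = refl
    ¬T⇒false {true}  ¬t = contradiction _ ¬t

  ≤ᵇ-true : ∀ {m n} → m ≤ n → (m ≤ᵇ n) ≡ true
  ≤ᵇ-true m≤n = Equivalence.to T-≡ (≤⇒≤ᵇ m≤n)

  ≤ᵇ-false : ∀ {m n} → n < m → (m ≤ᵇ n) ≡ false
  ≤ᵇ-false {m} {n} n<m = ¬T⇒false (λ t → <⇒≱ n<m (≤ᵇ⇒≤ m n t))

  ≤ᵇ-true⁻¹ : ∀ {m n} → (m ≤ᵇ n) ≡ true → m ≤ n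
  ≤ᵇ-true⁻¹ {m} {n} eq = ≤ᵇ⇒≤ m n (Equivalence.from T-≡ eq)

  ≤ᵇ-false⁻¹ : ∀ {m n} → (m ≤ᵇ n) ≡ false → n < m
  ≤ᵇ-false⁻¹ eq = ≰⇒> (λ m≤n → true≢false (trans (sym (≤ᵇ-true m≤n)) eq))
    where
    true≢false : true ≢ false
    true≢false ()

  ≡ᵇ-refl : ∀ n → (n ≡ᵇ n) ≡ true
  ≡ᵇ-refl n = Equivalence.to T-≡ (≡⇒≡ᵇ n n refl)

  ≡ᵇ-false : ∀ {m n} → m ≢ n → (m ≡ᵇ n) ≡ false
  ≡ᵇ-false {m} {n} m≢n = ¬T⇒false (λ t → m≢n (≡ᵇ⇒≡ m n t))

  ∧-true : ∀ {a b} → (a ∧ b) ≡ true → a ≡ true × b ≡ true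
  ∧-true {true} b≡true = refl , b≡true

-- The outer corners (r,s) with s ≠ 1 are exactly the squares (i, μ_i + 1) of the
-- "corner rows" i: μ_i > 0 and (i = 1 or μ_i < μ_{i-1}).
module Partitions where
  open import Relation.Binary.PropositionalEquality
  open import Data.Nat.Properties
  open import Data.Bool.Properties using (∧-identityʳ; ∧-zeroʳ)
  open import Data.List.Properties using (map-∘; map-cong-local; concatMap-map; map-concatMap)
  open import Data.List.Relation.Unary.All.Properties using (map⁺; concat⁺)
  open import Relation.Binary.Definitions using (tri<; tri≈; tri>)
  open Lists
  open Comparisons

  firstPart : List ℕ → ℕ
  firstPart μ = part μ 1

  dec-tail : ∀ {b μ} → Decreasing (b ∷ μ) → Decreasing μ
  dec-tail dec-[x]     = dec-[]
  dec-tail (dec-∷ _ d) = d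

  dec-first : ∀ {b μ} → Decreasing (b ∷ μ) → firstPart μ ≤ b
  dec-first dec-[x]         = z≤n
  dec-first (dec-∷ b'≤b _) = b'≤b

  part-≤-first : ∀ {μ} → Decreasing μ → ∀ i → part μ i ≤ firstPart μ
  part-≤-first {[]}    d i             = z≤n
  part-≤-first {a ∷ μ} d zero          = z≤n
  part-≤-first {a ∷ μ} d (suc zero)    = ≤-refl
  part-≤-first {a ∷ μ} d (suc (suc i)) = ≤-trans (part-≤-first (dec-tail d) (suc i)) (dec-first d)

  -- For a decreasing list the conjugate λ'_j is the number of leading parts ≥ j.
  colLength : List ℕ → ℕ → ℕ
  colLength []      j = 0
  colLength (a ∷ μ) j = if j ≤ᵇ a then suc (colLength μ j) else 0

  colLength-beyond : ∀ μ j → firstPart μ < j → colLength μ j ≡ 0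
  colLength-beyond []      j _   = refl
  colLength-beyond (a ∷ μ) j a<j rewrite ≤ᵇ-false {j} {a} a<j = refl

  -- `conjFrom k μ j` is the last index ≥ j counted from k: 0 if there is none.
  lastIndex : ℕ → ℕ → ℕ
  lastIndex k zero    = 0
  lastIndex k (suc n) = k + n

  conjFrom-colLength : ∀ {μ} → Decreasing μ → ∀ k j → conjFrom (suc k) μ j ≡ lastIndex (suc k) (colLength μ j)
  conjFrom-colLength {[]}    d k j = refl
  conjFrom-colLength {a ∷ μ} d k j with j ≤ᵇ a in j≤a
  ... | true rewrite conjFrom-colLength (dec-tail d) (suc k) j with colLength μ j
  ...   | zero  = trans (⊔-identityʳ (suc k)) (sym (+-identityʳ (suc k)))
  ...   | suc n = trans (m≤n⇒m⊔n≡n (≤-trans (n≤1+n (suc k)) (m≤m+n (suc (suc k)) n))) (sym (+-suc (suc k) n))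
  conjFrom-colLength {a ∷ μ} d k j | false
    rewrite conjFrom-colLength (dec-tail d) (suc k) j
          | colLength-beyond μ j (≤-<-trans (dec-first d) (≤ᵇ-false⁻¹ j≤a)) = refl

  conj-colLength : ∀ {μ} → Decreasing μ → ∀ j → conj μ j ≡ colLength μ j
  conj-colLength d j = trans (conjFrom-colLength d 0 j) (lastIndex-1 _)
    where
    lastIndex-1 : ∀ n → lastIndex 1 n ≡ n
    lastIndex-1 zero    = refl
    lastIndex-1 (suc n) = refl

  conj-cons : ∀ {b μ} → Decreasing (b ∷ μ) → ∀ j → j ≤ b → conj (b ∷ μ) j ≡ suc (conj μ j)
  conj-cons {b} {μ} d j j≤b = begin
    conj (b ∷ μ) j                                          ≡⟨ conj-colLength d j ⟩
    (if j ≤ᵇ b then suc (colLength μ j) else 0)             ≡⟨ cong (λ t → if t then suc (colLength μ j) else 0) (≤ᵇ-true j≤b) ⟩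
    suc (colLength μ j)                                      ≡⟨ cong suc (sym (conj-colLength (dec-tail d) j)) ⟩
    suc (conj μ j)                                           ∎
    where open ≡-Reasoning

  conj-beyond : ∀ {μ} → Decreasing μ → ∀ j → firstPart μ < j → conj μ j ≡ 0
  conj-beyond {μ} d j μ₁<j = trans (conj-colLength d j) (colLength-beyond μ j μ₁<j)

  -- Row i of μ ends at an outer corner (i, μ_i + 1) lying in a column s ≠ 1.
  cornerRow : List ℕ → ℕ → Bool
  cornerRow μ i = not (part μ i ≡ᵇ 0) ∧ ((i ≡ᵇ 1) ∨ (suc (part μ i) ≤ᵇ part μ (i ∸ 1)))

  part-zero : ∀ μ → part μ 0 ≡ 0
  part-zero []      = refl
  part-zero (a ∷ μ) = refl

  cornerRow-part : ∀ μ i → cornerRow μ i ≡ true → 1 ≤ part μ i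
  cornerRow-part μ i ok with part μ i | proj₁ (∧-true {not (part μ i ≡ᵇ 0)} ok)
  ... | suc p | _ = s≤s z≤n

  cornerRow-index : ∀ μ i → cornerRow μ i ≡ true → 1 ≤ i
  cornerRow-index μ zero    ok = contradiction (subst (1 ≤_) (part-zero μ) (cornerRow-part μ zero ok)) λ ()
  cornerRow-index μ (suc i) ok = s≤s z≤n

  corner-colLength : ∀ {μ} → Decreasing μ → ∀ i → cornerRow μ i ≡ true → colLength μ (suc (part μ i)) ≡ i ∸ 1
  corner-colLength {[]}    d i             ()
  corner-colLength {a ∷ μ} d zero          ()
  corner-colLength {a ∷ μ} d (suc zero)    ok rewrite ≤ᵇ-false {suc a} {a} ≤-refl = refl
  corner-colLength {a ∷ μ} d (suc (suc i)) ok =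
    trans (cong (λ t → if t then suc (colLength μ (suc (part μ (suc i)))) else 0) (≤ᵇ-true s≤a))
          (cong suc (corner-colLength (dec-tail d) (suc i) tail-ok))
    where
    s≤a : suc (part μ (suc i)) ≤ a
    s≤a = ≤-trans (≤ᵇ-true⁻¹ (proj₂ (∧-true ok))) (part-≤-first d (suc i))
    tail-ok : cornerRow μ (suc i) ≡ true
    tail-ok = lower i ok
      where
      lower : ∀ k → cornerRow (a ∷ μ) (suc (suc k)) ≡ true → cornerRow μ (suc k) ≡ true
      lower zero    o = trans (cong (_∧ true) (proj₁ (∧-true o))) (∧-identityʳ _)
      lower (suc k) o = o

  corner-conj : ∀ {μ} → Decreasing μ → ∀ i → cornerRow μ i ≡ true → conj μ (suc (part μ i)) ≡ i ∸ 1
  corner-conj d i ok = trans (conj-colLength d _) (corner-colLength d i ok)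

  cornerRow-cons : ∀ {b μ} → Decreasing (b ∷ μ) → ∀ i → 1 ≤ i →
                   cornerRow (b ∷ μ) (suc i) ≡ cornerRow μ i ∧ (suc (part μ i) ≤ᵇ b)
  cornerRow-cons {b} {μ} d (suc zero) _ with not (part μ 1 ≡ᵇ 0)
  ... | true  = refl
  ... | false = refl
  cornerRow-cons {b} {μ} d (suc (suc i)) _
    with not (part μ (suc (suc i)) ≡ᵇ 0) | suc (part μ (suc (suc i))) ≤ᵇ part μ (suc i) in below
  ... | false | _     = refl
  ... | true  | false = refl
  ... | true  | true  = sym (≤ᵇ-true (≤-trans (≤ᵇ-true⁻¹ below) (≤-trans (part-≤-first (dec-tail d) (suc i)) (dec-first d))))

  part-nonzero : ∀ μ i → 1 ≤ part μ i → 1 ≤ i × i ≤ length μ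
  part-nonzero (a ∷ μ) (suc zero)    _  = s≤s z≤n , s≤s z≤n
  part-nonzero (a ∷ μ) (suc (suc i)) 1≤μᵢ = s≤s z≤n , s≤s (proj₂ (part-nonzero μ (suc i) 1≤μᵢ))

  -- Membership in [μ] only depends on the length of row i (rows outside 1..ℓ have length 0).
  inDiagram-row : ∀ μ i j → inDiagram μ i j ≡ ((1 ≤ᵇ j) ∧ (j ≤ᵇ part μ i))
  inDiagram-row μ i j with (1 ≤ᵇ j) ∧ (j ≤ᵇ part μ i) in inRow
  ... | true with part-nonzero μ i (≤-trans (≤ᵇ-true⁻¹ {1} (proj₁ (∧-true inRow))) (≤ᵇ-true⁻¹ {j} (proj₂ (∧-true {1 ≤ᵇ j} inRow))))
  ...   | 1≤i , i≤ℓ rewrite ≤ᵇ-true 1≤i | ≤ᵇ-true i≤ℓ = refl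
  inDiagram-row μ i j | false with 1 ≤ᵇ i | i ≤ᵇ length μ
  ... | true  | true  = refl
  ... | true  | false = refl
  ... | false | _     = refl

  outerCorner-in-row : ∀ μ i k → 1 ≤ i →
    (isOuterCorner μ i (suc k) ∧ not (suc k ≡ᵇ 1)) ≡ ((k ≡ᵇ part μ i) ∧ cornerRow μ i)
  outerCorner-in-row μ (suc i) zero _ with part μ (suc i)
  ... | zero  = ∧-zeroʳ _
  ... | suc p = ∧-zeroʳ _
  outerCorner-in-row μ (suc i) (suc k) _
    rewrite inDiagram-row μ (suc i) (suc (suc k)) | inDiagram-row μ i (suc (suc k)) | inDiagram-row μ (suc i) (suc k)
    with <-cmp (suc k) (part μ (suc i))
  ... | tri< k<μᵢ _ _ rewrite ≤ᵇ-true k<μᵢ | ≡ᵇ-false (<⇒≢ k<μᵢ) = refl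
  ... | tri> _ _ μᵢ<k rewrite ≤ᵇ-false {suc (suc k)} (≤-trans μᵢ<k (n≤1+n _)) | ≤ᵇ-false μᵢ<k | ≡ᵇ-false (>⇒≢ μᵢ<k) =
    trans (∧-identityʳ _) (∧-zeroʳ _)
  ... | tri≈ _ k≡μᵢ _ rewrite sym k≡μᵢ | ≤ᵇ-false {suc (suc k)} {suc k} ≤-refl | ≡ᵇ-refl k | ≤ᵇ-true {suc k} ≤-refl =
    trans (∧-identityʳ _) (∧-identityʳ _)

  shiftDown : ℕ × ℕ → ℕ × ℕ
  shiftDown c = (suc (proj₁ c) , proj₂ c)

  firstRow : ℕ → List (ℕ × ℕ)
  firstRow b = map (λ j → (1 , j)) (range 1 b)

  diagram-cons : ∀ b μ → diagram (b ∷ μ) ≡ firstRow b ++ map shiftDown (diagram μ)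
  diagram-cons b μ = begin
    concatMap (row (b ∷ μ)) (range 1 (suc (length μ)))     ≡⟨ cong (concatMap (row (b ∷ μ))) (range-from-1 (length μ)) ⟩
    firstRow b ++ concatMap (row (b ∷ μ)) (map suc rows)    ≡⟨ cong (firstRow b ++_) (concatMap-map (row (b ∷ μ)) suc rows) ⟩
    firstRow b ++ concatMap (λ i → row (b ∷ μ) (suc i)) rows
      ≡⟨ cong (λ xss → firstRow b ++ concat xss) (map-cong-local (All-range 1 (length μ) (λ i 1≤i _ → lower-row i 1≤i))) ⟩
    firstRow b ++ concatMap (λ i → map shiftDown (row μ i)) rows ≡⟨ cong (firstRow b ++_) (sym (map-concatMap shiftDown (row μ) rows)) ⟩
    firstRow b ++ map shiftDown (diagram μ)                 ∎
    where
    open ≡-Reasoning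
    rows = range 1 (length μ)
    row : List ℕ → ℕ → List (ℕ × ℕ)
    row ν i = map (λ j → (i , j)) (range 1 (part ν i))
    lower-row : ∀ i → 1 ≤ i → row (b ∷ μ) (suc i) ≡ map shiftDown (row μ i)
    lower-row (suc i) _ = map-∘ (range 1 (part μ (suc i)))

  IsCell : List ℕ → ℕ × ℕ → Set
  IsCell μ c = 1 ≤ proj₁ c × proj₂ c ≤ part μ (proj₁ c)

  diagram-cells : ∀ μ → All (IsCell μ) (diagram μ)
  diagram-cells μ = concat⁺ (map⁺ (All-range 1 (length μ) (λ i 1≤i _ →
    map⁺ (All-range 1 (part μ i) (λ j _ j≤μᵢ → 1≤i , j≤μᵢ)))))

module RingLists {c ℓ : Level} (R : CommutativeRing c ℓ) where
  open CommutativeRing R hiding (zero) renaming (_+_ to _⊕_; _*_ to _⊛_)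
  open RingSums R
  open import Relation.Binary.Reasoning.Setoid setoid
  import Relation.Binary.PropositionalEquality as ≡
  import Data.Nat.Properties as ℕₚ
  open import Data.List.Properties using (map-∘; ++-identityʳ)
  open import Algebra.Properties.CommutativeSemigroup +-commutativeSemigroup using (interchange)
  open import Data.Bool.Properties using (if-∧)
  open Lists
  open Comparisons
  open Partitions

  private variable
    A B : Set

  ≡⇒≈ : ∀ {u v} → u ≡.≡ v → u ≈ v
  ≡⇒≈ ≡.refl = refl

  sum-++ : ∀ (f : A → Carrier) xs ys → sumL (map f (xs ++ ys)) ≈ sumL (map f xs) ⊕ sumL (map f ys)
  sum-++ f []       ys = sym (+-identityˡ _)
  sum-++ f (x ∷ xs) ys = trans (+-congˡ (sum-++ f xs ys)) (sym (+-assoc _ _ _))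

  prod-++ : ∀ (f : A → Carrier) xs ys → prodL (map f (xs ++ ys)) ≈ prodL (map f xs) ⊛ prodL (map f ys)
  prod-++ f []       ys = sym (*-identityˡ _)
  prod-++ f (x ∷ xs) ys = trans (*-congˡ (prod-++ f xs ys)) (sym (*-assoc _ _ _))

  sum-cong : ∀ (f g : A → Carrier) {xs} → All (λ a → f a ≈ g a) xs → sumL (map f xs) ≈ sumL (map g xs)
  sum-cong f g []       = refl
  sum-cong f g (e ∷ es) = +-cong e (sum-cong f g es)

  prod-cong : ∀ (f g : A → Carrier) {xs} → All (λ a → f a ≈ g a) xs → prodL (map f xs) ≈ prodL (map g xs)
  prod-cong f g []       = refl
  prod-cong f g (e ∷ es) = *-cong e (prod-cong f g es)

  sum-+ : ∀ (f g : A → Carrier) xs → sumL (map (λ a → f a ⊕ g a) xs) ≈ sumL (map f xs) ⊕ sumL (map g xs)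
  sum-+ f g []       = sym (+-identityˡ _)
  sum-+ f g (x ∷ xs) = trans (+-congˡ (sum-+ f g xs)) (interchange _ _ _ _)

  sum-*ˡ : ∀ k (f : A → Carrier) xs → k ⊛ sumL (map f xs) ≈ sumL (map (λ a → k ⊛ f a) xs)
  sum-*ˡ k f []       = zeroʳ k
  sum-*ˡ k f (x ∷ xs) = trans (distribˡ k _ _) (+-congˡ (sum-*ˡ k f xs))

  sum-filterB : ∀ (f : A → Carrier) (p : A → Bool) xs →
                sumL (map f (filterB p xs)) ≈ sumL (map (λ a → if p a then f a else 0#) xs)
  sum-filterB f p []       = refl
  sum-filterB f p (x ∷ xs) with p x
  ... | true  = +-congˡ (sum-filterB f p xs)
  ... | false = trans (sum-filterB f p xs) (sym (+-identityˡ _))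

  sum-concatMap : ∀ (f : B → Carrier) (g : A → List B) xs →
                  sumL (map f (concatMap g xs)) ≈ sumL (map (λ a → sumL (map f (g a))) xs)
  sum-concatMap f g []       = refl
  sum-concatMap f g (x ∷ xs) = trans (sum-++ f (g x) _) (+-congˡ (sum-concatMap f g xs))

  module _ (g : ℕ → Carrier) (t : ℕ) where
    δ : ℕ → Carrier
    δ j = if j ≡ᵇ t then g j else 0#

    private
      δ-off : ∀ j → ¬ j ≡.≡ t → δ j ≈ 0#
      δ-off j j≢t = ≡⇒≈ (≡.cong (λ e → if e then g j else 0#) (≡ᵇ-false j≢t))

      δ-on : δ t ≈ g t
      δ-on = ≡⇒≈ (≡.cong (λ e → if e then g t else 0#) (≡ᵇ-refl t))

    sum-δ-above : ∀ a n → t < a → sumL (map δ (iterate suc a n)) ≈ 0#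
    sum-δ-above a zero    t<a = refl
    sum-δ-above a (suc n) t<a =
      trans (+-cong (δ-off a (λ a≡t → ℕₚ.<-irrefl (≡.sym a≡t) t<a)) (sum-δ-above (suc a) n (ℕₚ.m<n⇒m<1+n t<a)))
            (+-identityˡ 0#)

    sum-δ-run : ∀ a n → a ≤ t → t < a + n → sumL (map δ (iterate suc a n)) ≈ g t
    sum-δ-run a zero    a≤t t<a+0 = contradiction a≤t (ℕₚ.<⇒≱ (≡.subst (t <_) (ℕₚ.+-identityʳ a) t<a+0))
    sum-δ-run a (suc n) a≤t t<a+n with a ≟ t
    ... | yes ≡.refl = trans (+-cong δ-on (sum-δ-above (suc a) n ℕₚ.≤-refl)) (+-identityʳ _)
    ... | no  a≢t    = trans (+-cong (δ-off a a≢t) (sum-δ-run (suc a) n (ℕₚ.≤∧≢⇒< a≤t a≢t) (≡.subst (t <_) (ℕₚ.+-suc a n) t<a+n)))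
                             (+-identityˡ _)

    sum-δ : ∀ a b → a ≤ t → t ≤ b → sumL (map δ (range a b)) ≈ g t
    sum-δ a b a≤t t≤b = trans (≡⇒≈ (≡.cong (λ l → sumL (map δ l)) (range-run a b)))
      (sum-δ-run a (suc b ∸ a) a≤t (≡.subst (t <_) (≡.sym (ℕₚ.m+[n∸m]≡n (ℕₚ.≤-trans a≤t (ℕₚ.m≤n⇒m≤1+n t≤b)))) (s≤s t≤b)))

  rsum-empty : ∀ (z : ℕ → Carrier) b → rsum z (suc b) b ≈ 0#
  rsum-empty z b = ≡⇒≈ (≡.cong (λ l → sumL (map z l)) (range-empty b))

  rsum-shift : ∀ (z : ℕ → Carrier) a b → rsum z (suc a) (suc b) ≡.≡ rsum (λ k → z (suc k)) a b
  rsum-shift z a b = ≡.cong sumL (≡.trans (≡.cong (map z) (range-shift a b)) (≡.sym (map-∘ (range a b))))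

  rsum-from-1 : ∀ (z : ℕ → Carrier) n → rsum z 1 (suc n) ≈ z 1 ⊕ rsum (λ k → z (suc k)) 1 n
  rsum-from-1 z n = ≡⇒≈ (≡.trans (≡.cong (λ l → sumL (map z l)) (range-from-1 n))
                                  (≡.cong (λ l → z 1 ⊕ sumL l) (≡.sym (map-∘ (range 1 n)))))

  prod-snocL : ∀ (f : A → Carrier) xs z → prodL (map f (xs ++ z ∷ [])) ≈ prodL (map f xs) ⊛ f z
  prod-snocL f xs z = trans (prod-++ f xs (z ∷ [])) (*-congˡ (*-identityʳ (f z)))

  rsum-snoc : ∀ (z : ℕ → Carrier) j a → j ≤ suc a → rsum z j (suc a) ≈ rsum z j a ⊕ z (suc a)
  rsum-snoc z j a j≤1+a = trans (≡⇒≈ (≡.cong (λ l → sumL (map z l)) (range-unsnoc j a j≤1+a)))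
                                (trans (sum-++ z (range j a) (suc a ∷ [])) (+-congˡ (+-identityʳ (z (suc a)))))

  without : ℕ → ℕ → Bool
  without s j = not (j ≡ᵇ s)

  without-other : ∀ s j → ¬ j ≡.≡ s → without s j ≡.≡ true
  without-other s j j≢s = ≡.cong not (≡ᵇ-false j≢s)

  without-below : ∀ s a b → b < s → filterB (without s) (range a b) ≡.≡ range a b
  without-below s a b b<s = filterB-all (without s) (All-range a b λ j _ j≤b → without-other s j (ℕₚ.<⇒≢ (ℕₚ.≤-<-trans j≤b b<s)))

  without-above : ∀ s a b → s < a → filterB (without s) (range a b) ≡.≡ range a b
  without-above s a b s<a = filterB-all (without s) (All-range a b λ j a≤j _ → without-other s j (ℕₚ.>⇒≢ (ℕₚ.<-≤-trans s<a a≤j)))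

  prod-snoc : ∀ (f : ℕ → Carrier) n → 1 ≤ n → prodL (map f (range 2 (suc n))) ≈ prodL (map f (range 2 n)) ⊛ f (suc n)
  prod-snoc f n 1≤n = trans (≡⇒≈ (≡.cong (λ l → prodL (map f l)) (range-unsnoc 2 n (s≤s 1≤n)))) (prod-snocL f (range 2 n) (suc n))

  prodWithout-snoc : ∀ (f : ℕ → Carrier) n s → 1 ≤ n → s ≤ n →
    prodL (map f (filterB (without s) (range 2 (suc n)))) ≈ prodL (map f (filterB (without s) (range 2 n))) ⊛ f (suc n)
  prodWithout-snoc f n s 1≤n s≤n = trans (≡⇒≈ (≡.cong (λ l → prodL (map f l)) kept)) (prod-snocL f (filterB (without s) (range 2 n)) (suc n))
    where
    kept : filterB (without s) (range 2 (suc n)) ≡.≡ filterB (without s) (range 2 n) ++ suc n ∷ []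
    kept = ≡.trans (≡.cong (filterB (without s)) (range-unsnoc 2 n (s≤s 1≤n)))
                   (≡.trans (filterB-++ (without s) (range 2 n) (suc n ∷ []))
                            (≡.cong (λ e → filterB (without s) (range 2 n) ++ (if e then suc n ∷ [] else []))
                                    (without-other s (suc n) (ℕₚ.>⇒≢ (s≤s s≤n)))))

  prodWithout-last : ∀ (f : ℕ → Carrier) n → 1 ≤ n →
    prodL (map f (filterB (without (suc n)) (range 2 (suc n)))) ≈ prodL (map f (range 2 n))
  prodWithout-last f n 1≤n = ≡⇒≈ (≡.cong (λ l → prodL (map f l)) dropped)
    where
    dropped : filterB (without (suc n)) (range 2 (suc n)) ≡.≡ range 2 n
    dropped = ≡.trans (≡.cong (filterB (without (suc n))) (range-unsnoc 2 n (s≤s 1≤n)))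
      (≡.trans (filterB-++ (without (suc n)) (range 2 n) (suc n ∷ []))
        (≡.trans (≡.cong₂ (λ l e → l ++ (if not e then suc n ∷ [] else [])) (without-below (suc n) 2 n ℕₚ.≤-refl) (≡ᵇ-refl n))
                 (++-identityʳ (range 2 n))))

  prod-extract : ∀ (f : ℕ → Carrier) n s → 2 ≤ s → s ≤ n →
    prodL (map f (range 2 n)) ≈ prodL (map f (filterB (without s) (range 2 n))) ⊛ f s
  prod-extract f n (suc t) (s≤s 1≤t) s≤n = begin
    prodL (map f (range 2 n))                         ≡⟨ ≡.cong (λ l → prodL (map f l)) split ⟩
    prodL (map f (range 2 t ++ suc t ∷ rest))         ≈⟨ prod-++ f (range 2 t) (suc t ∷ rest) ⟩
    Π₁ ⊛ (f (suc t) ⊛ Π₂)                             ≈⟨ *-congˡ (*-comm (f (suc t)) Π₂) ⟩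
    Π₁ ⊛ (Π₂ ⊛ f (suc t))                             ≈⟨ sym (*-assoc Π₁ Π₂ (f (suc t))) ⟩
    (Π₁ ⊛ Π₂) ⊛ f (suc t)                             ≈⟨ *-congʳ (sym (prod-++ f (range 2 t) rest)) ⟩
    prodL (map f (range 2 t ++ rest)) ⊛ f (suc t)     ≡⟨ ≡.cong (λ l → prodL (map f l) ⊛ f (suc t)) (≡.sym kept) ⟩
    prodL (map f (filterB (without (suc t)) (range 2 n))) ⊛ f (suc t) ∎
    where
    rest = range (suc (suc t)) n
    Π₁ = prodL (map f (range 2 t))
    Π₂ = prodL (map f rest)
    split : range 2 n ≡.≡ range 2 t ++ suc t ∷ rest
    split = ≡.trans (range-split 2 t n (s≤s 1≤t) (ℕₚ.≤-trans (ℕₚ.n≤1+n t) s≤n)) (≡.cong (range 2 t ++_) (range-uncons (suc t) n s≤n))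
    kept : filterB (without (suc t)) (range 2 n) ≡.≡ range 2 t ++ rest
    kept = ≡.trans (≡.cong (filterB (without (suc t))) split)
      (≡.trans (filterB-++ (without (suc t)) (range 2 t) (suc t ∷ rest))
        (≡.cong₂ _++_ (without-below (suc t) 2 t ℕₚ.≤-refl)
          (≡.trans (≡.cong (λ e → if not e then suc t ∷ filterB (without (suc t)) rest else filterB (without (suc t)) rest) (≡ᵇ-refl t))
                   (without-above (suc t) (suc (suc t)) n ℕₚ.≤-refl))))

  cornerTerm : List ℕ → (ℕ × ℕ → Carrier) → ℕ → Carrier
  cornerTerm μ F i = if cornerRow μ i then F (i , suc (part μ i)) else 0#

  cornerSum : List ℕ → (ℕ × ℕ → Carrier) → Carrier
  cornerSum μ F = sumL (map (cornerTerm μ F) (range 1 (suc (length μ))))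

  outerCorners≠1 : List ℕ → List (ℕ × ℕ)
  outerCorners≠1 μ = filterB (λ c → not (proj₂ c ≡ᵇ 1)) (outerCorners μ)

  corners-by-row : ∀ μ → Decreasing μ → ∀ F → sumL (map F (outerCorners≠1 μ)) ≈ cornerSum μ F
  corners-by-row μ d F = begin
    sumL (map F (filterB p (outerCorners μ)))            ≈⟨ sum-filterB F p (outerCorners μ) ⟩
    sumL (map (λ c → if p c then F c else 0#) (filterB q square)) ≈⟨ sum-filterB _ q square ⟩
    sumL (map G square)                                  ≈⟨ sum-concatMap G row (range 1 (suc (length μ))) ⟩
    sumL (map (λ i → sumL (map G (row i))) (range 1 (suc (length μ))))
      ≈⟨ sum-cong _ _ (All-range 1 (suc (length μ)) (λ i 1≤i _ → row-sum i 1≤i)) ⟩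
    cornerSum μ F                                        ∎
    where
    p q : ℕ × ℕ → Bool
    p c = not (proj₂ c ≡ᵇ 1)
    q c = isOuterCorner μ (proj₁ c) (proj₂ c)
    G : ℕ × ℕ → Carrier
    G c = if q c then (if p c then F c else 0#) else 0#
    square = box 1 (suc (length μ)) 1 (suc (firstPart μ))
    row : ℕ → List (ℕ × ℕ)
    row i = map (λ j → (i , j)) (range 1 (suc (firstPart μ)))
    rowValue : ℕ → ℕ → Carrier
    rowValue i j = if cornerRow μ i then F (i , j) else 0#
    G-in-row : ∀ i → 1 ≤ i → ∀ j → 1 ≤ j → G (i , j) ≈ δ (rowValue i) (suc (part μ i)) j
    G-in-row i 1≤i (suc k) _ = ≡⇒≈ (≡.trans (≡.sym (if-∧ (q (i , suc k))))
      (≡.trans (≡.cong (λ e → if e then F (i , suc k) else 0#) (outerCorner-in-row μ i k 1≤i)) (if-∧ (k ≡ᵇ part μ i))))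
    row-sum : ∀ i → 1 ≤ i → sumL (map G (row i)) ≈ cornerTerm μ F i
    row-sum i 1≤i = begin
      sumL (map G (row i))                                     ≡⟨ ≡.cong sumL (≡.sym (map-∘ (range 1 (suc (firstPart μ))))) ⟩
      sumL (map (λ j → G (i , j)) (range 1 (suc (firstPart μ))))
        ≈⟨ sum-cong _ _ (All-range 1 (suc (firstPart μ)) (λ j 1≤j _ → G-in-row i 1≤i j 1≤j)) ⟩
      sumL (map (δ (rowValue i) (suc (part μ i))) (range 1 (suc (firstPart μ))))
        ≈⟨ sum-δ _ (suc (part μ i)) 1 (suc (firstPart μ)) (s≤s z≤n) (s≤s (part-≤-first d i)) ⟩
      cornerTerm μ F i                                         ∎

  cornerSum-cong : ∀ μ (F G : ℕ × ℕ → Carrier) →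
    (∀ i → cornerRow μ i ≡.≡ true → F (i , suc (part μ i)) ≈ G (i , suc (part μ i))) → cornerSum μ F ≈ cornerSum μ G
  cornerSum-cong μ F G F≈G = sum-cong (cornerTerm μ F) (cornerTerm μ G) (All.universal term≈ (range 1 (suc (length μ))))
    where
    term≈ : ∀ i → cornerTerm μ F i ≈ cornerTerm μ G i
    term≈ i with cornerRow μ i in ok
    ... | true  = F≈G i ok
    ... | false = refl

  cornerSum-*ˡ : ∀ μ k (F : ℕ × ℕ → Carrier) → k ⊛ cornerSum μ F ≈ cornerSum μ (λ c → k ⊛ F c)
  cornerSum-*ˡ μ k F = trans (sum-*ˡ k (cornerTerm μ F) rows) (sum-cong _ _ (All.universal term≈ rows))
    where
    rows = range 1 (suc (length μ))
    term≈ : ∀ i → k ⊛ cornerTerm μ F i ≈ cornerTerm μ (λ c → k ⊛ F c) i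
    term≈ i with cornerRow μ i
    ... | true  = refl
    ... | false = zeroʳ k

  -- The corners of μ whose shift one row down is a corner of b ∷ μ, i.e. those in a column ≤ b.
  lowerTerm : List ℕ → ℕ → (ℕ × ℕ → Carrier) → ℕ → Carrier
  lowerTerm μ b F i = if cornerRow μ i then (if suc (part μ i) ≤ᵇ b then F (suc i , suc (part μ i)) else 0#) else 0#

  lowerSum : List ℕ → ℕ → (ℕ × ℕ → Carrier) → Carrier
  lowerSum μ b F = sumL (map (lowerTerm μ b F) (range 1 (suc (length μ))))

  cornerSum-cons : ∀ {b μ} → Decreasing (b ∷ μ) → 1 ≤ b → ∀ F → cornerSum (b ∷ μ) F ≈ F (1 , suc b) ⊕ lowerSum μ b F
  cornerSum-cons {suc b'} {μ} d _ F =
    trans (≡⇒≈ (≡.cong (λ l → sumL (map (cornerTerm (suc b' ∷ μ) F) l)) (range-from-1 (suc (length μ)))))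
          (+-congˡ (trans (≡⇒≈ (≡.cong sumL (≡.sym (map-∘ (range 1 (suc (length μ)))))))
                          (sum-cong _ _ (All-range 1 (suc (length μ)) (λ i 1≤i _ → ≡⇒≈ (lower i 1≤i))))))
    where
    lower : ∀ i → 1 ≤ i → cornerTerm (suc b' ∷ μ) F (suc i) ≡.≡ lowerTerm μ (suc b') F i
    lower (suc i) 1≤i = ≡.trans (≡.cong (λ e → if e then F (suc (suc i) , suc (part μ (suc i))) else 0#) (cornerRow-cons d (suc i) 1≤i))
                                (if-∧ (cornerRow μ (suc i)))

  cornerSum-split : ∀ {b μ} → Decreasing (b ∷ μ) → ∀ (K K' H : ℕ × ℕ → Carrier) →
    (∀ i → cornerRow μ i ≡.≡ true → suc (part μ i) ≤ b →
       K (i , suc (part μ i)) ≈ K' (i , suc (part μ i)) ⊕ H (suc i , suc (part μ i))) →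
    (∀ i → K (i , suc b) ≈ K' (i , suc b)) →
    cornerSum μ K ≈ cornerSum μ K' ⊕ lowerSum μ b H
  cornerSum-split {b} {μ} d K K' H below top =
    trans (sum-cong _ _ (All.universal term≈ rows)) (sum-+ (cornerTerm μ K') (lowerTerm μ b H) rows)
    where
    rows = range 1 (suc (length μ))
    term≈ : ∀ i → cornerTerm μ K i ≈ cornerTerm μ K' i ⊕ lowerTerm μ b H i
    term≈ i with cornerRow μ i in ok | suc (part μ i) ≤ᵇ b in s≤b
    ... | false | _     = sym (+-identityʳ 0#)
    ... | true  | true  = below i ok (≤ᵇ-true⁻¹ s≤b)
    ... | true  | false rewrite ℕₚ.≤-antisym (ℕₚ.≤-trans (part-≤-first (dec-tail d) i) (dec-first d)) (ℕₚ.≤-pred (≤ᵇ-false⁻¹ s≤b)) =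
      trans (top i) (sym (+-identityʳ _))

-- Hooks of a virtual row 0 sitting on top of a partition μ.
module TopRow {c ℓ : Level} (R : CommutativeRing c ℓ) (y : ℕ → CommutativeRing.Carrier R) where
  open CommutativeRing R hiding (zero) renaming (_+_ to _⊕_; _*_ to _⊛_)
  open RingSums R
  open RingLists R
  open import Relation.Binary.Reasoning.Setoid setoid
  open import Algebra.Solver.Ring.NaturalCoefficients.Default commutativeSemiring
  import Relation.Binary.PropositionalEquality as ≡
  import Data.Nat.Properties as ℕₚ
  open Lists
  open Partitions

  hookProduct : List ℕ → (ℕ → Carrier) → Carrier
  hookProduct μ x = prodL (map (hookFactor μ x y) (filterB (λ c → not (proj₂ c ≡ᵇ 1)) (diagram μ)))

  -- Putting a row of length a on top of μ, the cell (0, j) has hook  x₀ + topHook μ x a j,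
  -- and the arm factor of the theorem along that row is  x₀ + topArm μ x a j.
  topHook : List ℕ → (ℕ → Carrier) → ℕ → ℕ → Carrier
  topHook μ x a j = rsum y j a ⊕ rsum x 1 (conj μ j)

  topArm : List ℕ → (ℕ → Carrier) → ℕ → ℕ → Carrier
  topArm μ x a j = rsum y (suc j) a ⊕ rsum x 1 (conj μ j)

  hooksOver : List ℕ → (ℕ → Carrier) → ℕ → Carrier → List ℕ → Carrier
  hooksOver μ x a w cols = prodL (map (λ j → w ⊕ topHook μ x a j) cols)

  hookRow : List ℕ → (ℕ → Carrier) → ℕ → Carrier → ℕ → Carrier
  hookRow μ x a w n = hooksOver μ x a w (range 2 n)

  hookRowWithout : List ℕ → (ℕ → Carrier) → ℕ → Carrier → ℕ → ℕ → Carrier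
  hookRowWithout μ x a w n s = hooksOver μ x a w (filterB (without s) (range 2 n))

  armRow : List ℕ → (ℕ → Carrier) → ℕ → Carrier → Carrier
  armRow μ x a w = prodL (map (λ j → w ⊕ topArm μ x a j) (range 1 a))

  dropFirst : (ℕ → Carrier) → ℕ → Carrier
  dropFirst x k = x (suc k)

  -- Beyond the first row of μ there is nothing below the top row, so the hook is empty.
  topHook-last : ∀ {μ} → Decreasing μ → ∀ x a → firstPart μ ≤ a → topHook μ x a (suc a) ≈ 0#
  topHook-last d x a μ₁≤a =
    trans (+-cong (rsum-empty y a) (≡⇒≈ (≡.cong (rsum x 1) (conj-beyond d (suc a) (s≤s μ₁≤a))))) (+-identityʳ 0#)

  topArm-last : ∀ {μ} → Decreasing μ → ∀ x a → firstPart μ < a → topArm μ x a a ≈ 0#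
  topArm-last d x a μ₁<a =
    trans (+-cong (rsum-empty y a) (≡⇒≈ (≡.cong (rsum x 1) (conj-beyond d a μ₁<a)))) (+-identityʳ 0#)

  rsum-conj-cons : ∀ {b μ} → Decreasing (b ∷ μ) → ∀ x j → j ≤ b →
                   rsum x 1 (conj (b ∷ μ) j) ≈ x 1 ⊕ rsum (dropFirst x) 1 (conj μ j)
  rsum-conj-cons {μ = μ} d x j j≤b = trans (≡⇒≈ (≡.cong (rsum x 1) (conj-cons d j j≤b))) (rsum-from-1 x (conj μ j))

  private
    move : ∀ w u v t → w ⊕ (u ⊕ (v ⊕ t)) ≈ (w ⊕ v) ⊕ (u ⊕ t)
    move = solve 4 (λ w u v t → w :+ (u :+ (v :+ t)) := (w :+ v) :+ (u :+ t)) refl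

  topHook-cons : ∀ {b μ} → Decreasing (b ∷ μ) → ∀ x a w j → j ≤ b →
                 w ⊕ topHook (b ∷ μ) x a j ≈ (w ⊕ x 1) ⊕ topHook μ (dropFirst x) a j
  topHook-cons d x a w j j≤b = trans (+-congˡ (+-congˡ (rsum-conj-cons d x j j≤b))) (move _ _ _ _)

  topArm-cons : ∀ {b μ} → Decreasing (b ∷ μ) → ∀ x a w j → j ≤ b →
                w ⊕ topArm (b ∷ μ) x a j ≈ (w ⊕ x 1) ⊕ topArm μ (dropFirst x) a j
  topArm-cons d x a w j j≤b = trans (+-congˡ (+-congˡ (rsum-conj-cons d x j j≤b))) (move _ _ _ _)

  topHook-extend : ∀ μ x a w j → j ≤ suc a → w ⊕ topHook μ x (suc a) j ≈ (w ⊕ y (suc a)) ⊕ topHook μ x a j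
  topHook-extend μ x a w j j≤1+a = trans (+-congˡ (+-congʳ (rsum-snoc y j a j≤1+a)))
    (solve 4 (λ w u v t → w :+ ((u :+ v) :+ t) := (w :+ v) :+ (u :+ t)) refl _ _ _ _)

  topArm-extend : ∀ μ x a w j → j ≤ a → w ⊕ topArm μ x (suc a) j ≈ (w ⊕ y (suc a)) ⊕ topArm μ x a j
  topArm-extend μ x a w j j≤a = trans (+-congˡ (+-congʳ (rsum-snoc y (suc j) a (s≤s j≤a))))
    (solve 4 (λ w u v t → w :+ ((u :+ v) :+ t) := (w :+ v) :+ (u :+ t)) refl _ _ _ _)

  hooksOver-cons : ∀ {b μ} → Decreasing (b ∷ μ) → ∀ x a w {cols} → All (_≤ b) cols →
                   hooksOver (b ∷ μ) x a w cols ≈ hooksOver μ (dropFirst x) a (w ⊕ x 1) cols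
  hooksOver-cons d x a w cols≤b = prod-cong _ _ (All.map (λ {j} → topHook-cons d x a w j) cols≤b)

  hooksOver-extend : ∀ μ x a w {cols} → All (_≤ suc a) cols →
                     hooksOver μ x (suc a) w cols ≈ hooksOver μ x a (w ⊕ y (suc a)) cols
  hooksOver-extend μ x a w cols≤ = prod-cong _ _ (All.map (λ {j} → topHook-extend μ x a w j) cols≤)

  hookRow-last : ∀ {μ} → Decreasing μ → ∀ x a w → 1 ≤ a → firstPart μ ≤ a →
                 hookRow μ x a w (suc a) ≈ hookRow μ x a w a ⊛ w
  hookRow-last d x a w 1≤a μ₁≤a =
    trans (prod-snoc _ a 1≤a) (*-congˡ (trans (+-congˡ (topHook-last d x a μ₁≤a)) (+-identityʳ w)))

  hookRowWithout-last : ∀ {μ} → Decreasing μ → ∀ x a w s → 1 ≤ a → firstPart μ ≤ a → s ≤ a →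
                        hookRowWithout μ x a w (suc a) s ≈ hookRowWithout μ x a w a s ⊛ w
  hookRowWithout-last d x a w s 1≤a μ₁≤a s≤a =
    trans (prodWithout-snoc _ a s 1≤a s≤a) (*-congˡ (trans (+-congˡ (topHook-last d x a μ₁≤a)) (+-identityʳ w)))

  armRow-cons : ∀ {b μ} → Decreasing (b ∷ μ) → ∀ x a w → a ≤ b →
                armRow (b ∷ μ) x a w ≈ armRow μ (dropFirst x) a (w ⊕ x 1)
  armRow-cons d x a w a≤b = prod-cong _ _ (All-range 1 a (λ j _ j≤a → topArm-cons d x a w j (ℕₚ.≤-trans j≤a a≤b)))

  armRow-extend : ∀ {μ} → Decreasing μ → ∀ x a w → firstPart μ ≤ a →
                  armRow μ x (suc a) w ≈ armRow μ x a (w ⊕ y (suc a)) ⊛ w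
  armRow-extend {μ} d x a w μ₁≤a = begin
    armRow μ x (suc a) w                                           ≡⟨ ≡.cong (λ l → prodL (map arm l)) (range-unsnoc 1 a (s≤s z≤n)) ⟩
    prodL (map arm (range 1 a ++ suc a ∷ []))                      ≈⟨ prod-snocL arm (range 1 a) (suc a) ⟩
    prodL (map arm (range 1 a)) ⊛ arm (suc a)
      ≈⟨ *-cong (prod-cong _ _ (All-range 1 a (λ j _ j≤a → topArm-extend μ x a w j j≤a)))
                (trans (+-congˡ (topArm-last d x (suc a) (s≤s μ₁≤a))) (+-identityʳ w)) ⟩
    armRow μ x a (w ⊕ y (suc a)) ⊛ w                               ∎
    where
    arm : ℕ → Carrier
    arm j = w ⊕ topArm μ x (suc a) j

  hookRow-extend : ∀ {μ} → Decreasing μ → ∀ x a w → firstPart μ ≤ a →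
                   hookRow μ x (suc a) w (suc (suc a)) ≈ hookRow μ x a (w ⊕ y (suc a)) (suc a) ⊛ w
  hookRow-extend {μ} d x a w μ₁≤a = trans (hookRow-last d x (suc a) w (s≤s z≤n) (ℕₚ.m≤n⇒m≤1+n μ₁≤a))
    (*-congʳ (hooksOver-extend μ x a w (All-range 2 (suc a) λ _ _ j≤ → j≤)))

  hookRowWithout-extend : ∀ {μ} → Decreasing μ → ∀ x a w s → firstPart μ ≤ a → s ≤ suc a →
                          hookRowWithout μ x (suc a) w (suc (suc a)) s ≈ hookRowWithout μ x a (w ⊕ y (suc a)) (suc a) s ⊛ w
  hookRowWithout-extend {μ} d x a w s μ₁≤a s≤1+a = trans (hookRowWithout-last d x (suc a) w s (s≤s z≤n) (ℕₚ.m≤n⇒m≤1+n μ₁≤a) s≤1+a)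
    (*-congʳ (hooksOver-extend μ x a w (All-filterB (without s) (All-range 2 (suc a) λ _ _ j≤ → j≤))))

module FirstRow {c ℓ : Level} (R : CommutativeRing c ℓ) (y : ℕ → CommutativeRing.Carrier R)
                {b : ℕ} {μ : List ℕ} (d : Decreasing (b ∷ μ)) (x : ℕ → CommutativeRing.Carrier R) where
  open CommutativeRing R hiding (zero) renaming (_+_ to _⊕_; _*_ to _⊛_)
  open RingSums R
  open RingLists R
  open TopRow R y
  open import Relation.Binary.Reasoning.Setoid setoid
  open import Algebra.Solver.Ring.NaturalCoefficients.Default commutativeSemiring
  import Relation.Binary.PropositionalEquality as ≡
  import Data.Nat.Properties as ℕₚ
  open import Data.List.Properties using (map-∘)
  open import Data.Bool.Properties using (∧-identityʳ)
  open Lists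
  open Comparisons
  open Partitions

  x' : ℕ → Carrier
  x' = dropFirst x

  hookFactor-firstRow : ∀ j → j ≤ b → hookFactor (b ∷ μ) x y (1 , j) ≈ x 1 ⊕ topHook μ x' b j
  hookFactor-firstRow j j≤b = trans (+-congʳ (rsum-conj-cons d x j j≤b))
    (solve 3 (λ u v t → (u :+ v) :+ t := u :+ (t :+ v)) refl _ _ _)

  hookFactor-shift : ∀ c → IsCell μ c → hookFactor (b ∷ μ) x y (shiftDown c) ≡.≡ hookFactor μ x' y c
  hookFactor-shift (suc i , j) (_ , j≤μᵢ) = ≡.cong (_⊕ rsum y j (part μ (suc i)))
    (≡.trans (≡.cong (rsum x (suc (suc i))) (conj-cons d j j≤b)) (rsum-shift x (suc i) (conj μ j)))
    where
    j≤b : j ≤ b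
    j≤b = ℕₚ.≤-trans j≤μᵢ (ℕₚ.≤-trans (part-≤-first (dec-tail d) (suc i)) (dec-first d))

  hookProduct-split : ∀ (p : ℕ × ℕ → Bool) →
    prodL (map (hookFactor (b ∷ μ) x y) (filterB p (diagram (b ∷ μ))))
      ≈ hooksOver μ x' b (x 1) (filterB (λ j → p (1 , j)) (range 1 b))
        ⊛ prodL (map (hookFactor μ x' y) (filterB (λ c → p (shiftDown c)) (diagram μ)))
  hookProduct-split p = begin
    prodL (map hλ (filterB p (diagram (b ∷ μ))))
      ≡⟨ ≡.cong (λ l → prodL (map hλ (filterB p l))) (diagram-cons b μ) ⟩
    prodL (map hλ (filterB p (firstRow b ++ map shiftDown (diagram μ))))
      ≡⟨ ≡.cong (λ l → prodL (map hλ l)) (≡.trans (filterB-++ p (firstRow b) _)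
           (≡.cong₂ _++_ (filterB-map p (λ j → (1 , j)) (range 1 b)) (filterB-map p shiftDown (diagram μ)))) ⟩
    prodL (map hλ (map (λ j → (1 , j)) top ++ map shiftDown rest))
      ≈⟨ prod-++ hλ (map (λ j → (1 , j)) top) _ ⟩
    prodL (map hλ (map (λ j → (1 , j)) top)) ⊛ prodL (map hλ (map shiftDown rest))
      ≈⟨ *-cong (trans (≡⇒≈ (≡.cong prodL (≡.sym (map-∘ top))))
                       (prod-cong _ _ (All-filterB _ (All-range 1 b (λ j _ j≤b → hookFactor-firstRow j j≤b)))))
                (trans (≡⇒≈ (≡.cong prodL (≡.sym (map-∘ rest))))
                       (prod-cong _ _ (All.map (λ {c} cell → ≡⇒≈ (hookFactor-shift c cell)) (All-filterB _ (diagram-cells μ))))) ⟩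
    hooksOver μ x' b (x 1) top ⊛ prodL (map (hookFactor μ x' y) rest) ∎
    where
    hλ = hookFactor (b ∷ μ) x y
    top = filterB (λ j → p (1 , j)) (range 1 b)
    rest = filterB (λ c → p (shiftDown c)) (diagram μ)

  hookProduct-cons : 1 ≤ b → hookProduct (b ∷ μ) x ≈ hookRow μ x' b (x 1) b ⊛ hookProduct μ x'
  hookProduct-cons 1≤b = trans (hookProduct-split (λ c → without 1 (proj₂ c)))
    (*-congʳ (≡⇒≈ (≡.cong (hooksOver μ x' b (x 1)) columns)))
    where
    columns : filterB (without 1) (range 1 b) ≡.≡ range 2 b
    columns = ≡.trans (≡.cong (filterB (without 1)) (range-uncons 1 b 1≤b)) (without-above 1 2 b ℕₚ.≤-refl)

  term-firstCorner : term (b ∷ μ) x y (1 , suc b) ≈ hookProduct μ x' ⊛ armRow μ x' b (x 1)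
  term-firstCorner = *-cong (trans (*-congʳ cells) (*-identityʳ _)) arms
    where
    p : ℕ × ℕ → Bool
    p c = not (proj₁ c ≡ᵇ 1) ∧ not (proj₂ c ≡ᵇ 1) ∧ not (proj₂ c ≡ᵇ suc b)
    lower : ∀ c → IsCell μ c → p (shiftDown c) ≡.≡ without 1 (proj₂ c)
    lower (suc i , j) (_ , j≤μᵢ) rewrite ≡ᵇ-false (ℕₚ.<⇒≢ (s≤s (ℕₚ.≤-trans j≤μᵢ (ℕₚ.≤-trans (part-≤-first (dec-tail d) (suc i)) (dec-first d))))) =
      ∧-identityʳ _
    cells : prodL (map (hookFactor (b ∷ μ) x y) (filterB p (diagram (b ∷ μ)))) ≈ hookProduct μ x'
    cells = begin
      prodL (map (hookFactor (b ∷ μ) x y) (filterB p (diagram (b ∷ μ)))) ≈⟨ hookProduct-split p ⟩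
      hooksOver μ x' b (x 1) (filterB (λ j → p (1 , j)) (range 1 b))
        ⊛ prodL (map (hookFactor μ x' y) (filterB (λ c → p (shiftDown c)) (diagram μ)))
        ≡⟨ ≡.cong₂ (λ l l' → hooksOver μ x' b (x 1) l ⊛ prodL (map (hookFactor μ x' y) l'))
                   (filterB-none _ (All.universal (λ _ → ≡.refl) (range 1 b)))
                   (filterB-cong _ _ (All.map (λ {c} → lower c) (diagram-cells μ))) ⟩
      1# ⊛ hookProduct μ x'               ≈⟨ *-identityˡ _ ⟩
      hookProduct μ x'                    ∎
    arms : prodL (map (λ j → rsum x 1 (conj (b ∷ μ) j) ⊕ rsum y (suc j) b) (range 1 b)) ≈ armRow μ x' b (x 1)
    arms = prod-cong _ _ (All-range 1 b λ j _ j≤b → trans (+-congʳ (rsum-conj-cons d x j j≤b))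
      (solve 3 (λ u v t → (u :+ v) :+ t := u :+ (t :+ v)) refl _ _ _))

  term-lowerCorner : ∀ i → cornerRow μ i ≡.≡ true → suc (part μ i) ≤ b →
    term (b ∷ μ) x y (suc i , suc (part μ i))
      ≈ (term μ x' y (i , suc (part μ i)) ⊛ hookRowWithout μ x' b (x 1) b (suc (part μ i))) ⊛ topHook μ x' b (suc (part μ i))
  term-lowerCorner zero    ok _   = contradiction (cornerRow-index μ zero ok) λ ()
  term-lowerCorner (suc i) ok s≤b = trans (*-cong (*-cong cells column) row)
    (solve 5 (λ G C E K L → ((G :* C) :* (E :* K)) :* L := (((C :* K) :* L) :* G) :* E) refl _ _ _ _ _)
    where
    s = suc (part μ (suc i))
    pλ pμ : ℕ × ℕ → Bool
    pλ c = not (proj₁ c ≡ᵇ suc (suc i)) ∧ not (proj₂ c ≡ᵇ 1) ∧ not (proj₂ c ≡ᵇ s)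
    pμ c = not (proj₁ c ≡ᵇ suc i) ∧ not (proj₂ c ≡ᵇ 1) ∧ not (proj₂ c ≡ᵇ s)
    columns : filterB (λ j → pλ (1 , j)) (range 1 b) ≡.≡ filterB (without s) (range 2 b)
    columns = ≡.trans (≡.cong (filterB (λ j → pλ (1 , j))) (range-uncons 1 b (ℕₚ.≤-trans (s≤s z≤n) s≤b)))
      (filterB-cong _ _ (All-range 2 b λ j 2≤j _ → ≡.cong (_∧ without s j) (without-other 1 j (ℕₚ.>⇒≢ 2≤j))))
    cells : prodL (map (hookFactor (b ∷ μ) x y) (filterB pλ (diagram (b ∷ μ))))
            ≈ hookRowWithout μ x' b (x 1) b s ⊛ prodL (map (hookFactor μ x' y) (filterB pμ (diagram μ)))
    cells = trans (hookProduct-split pλ) (*-congʳ (≡⇒≈ (≡.cong (hooksOver μ x' b (x 1)) columns)))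
    -- The column above (i+1, s) in b ∷ μ is the column above (i, s) in μ plus the cell (1, s),
    -- whose factor is the hook of (0, s) over μ since μ'_s = i - 1.
    colλ colμ : ℕ → Carrier
    colλ k = rsum x (suc k) (suc i) ⊕ rsum y s (part (b ∷ μ) k)
    colμ k = rsum x' (suc k) i ⊕ rsum y s (part μ k)
    column : prodL (map colλ (range 1 (suc i))) ≈ topHook μ x' b s ⊛ prodL (map colμ (range 1 i))
    column = begin
      prodL (map colλ (range 1 (suc i)))              ≡⟨ ≡.cong (λ l → prodL (map colλ l)) (range-from-1 i) ⟩
      colλ 1 ⊛ prodL (map colλ (map suc (range 1 i))) ≈⟨ *-cong top (trans (≡⇒≈ (≡.cong prodL (≡.sym (map-∘ (range 1 i)))))
                                                              (prod-cong _ _ (All-range 1 i λ k 1≤k _ → ≡⇒≈ (below k 1≤k)))) ⟩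
      topHook μ x' b s ⊛ prodL (map colμ (range 1 i)) ∎
      where
      top : colλ 1 ≈ topHook μ x' b s
      top = trans (+-comm _ _) (+-congˡ (≡⇒≈ (≡.trans (rsum-shift x 1 i)
                                                      (≡.cong (rsum x' 1) (≡.sym (corner-conj (dec-tail d) (suc i) ok))))))
      below : ∀ k → 1 ≤ k → colλ (suc k) ≡.≡ colμ k
      below (suc k) _ = ≡.cong (_⊕ rsum y s (part μ (suc k))) (rsum-shift x (suc (suc k)) i)
    row : prodL (map (λ j → rsum x (suc (suc i)) (conj (b ∷ μ) j) ⊕ rsum y (suc j) (s ∸ 1)) (range 1 (s ∸ 1)))
          ≈ prodL (map (λ j → rsum x' (suc i) (conj μ j) ⊕ rsum y (suc j) (s ∸ 1)) (range 1 (s ∸ 1)))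
    row = prod-cong _ _ (All-range 1 (s ∸ 1) λ j _ j≤μᵢ → ≡⇒≈ (≡.cong (_⊕ rsum y (suc j) (s ∸ 1))
      (≡.trans (≡.cong (rsum x (suc (suc i))) (conj-cons d j (ℕₚ.≤-trans j≤μᵢ (ℕₚ.≤-trans (ℕₚ.n≤1+n _) s≤b))))
               (rsum-shift x (suc i) (conj μ j)))))

module Identities {c ℓ : Level} (R : CommutativeRing c ℓ) (y : ℕ → CommutativeRing.Carrier R) where
  open CommutativeRing R hiding (zero) renaming (_+_ to _⊕_; _*_ to _⊛_)
  open RingSums R
  open RingLists R
  open TopRow R y
  open import Relation.Binary.Reasoning.Setoid setoid
  open import Algebra.Solver.Ring.NaturalCoefficients.Default commutativeSemiring
  import Relation.Binary.PropositionalEquality as ≡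
  import Data.Nat.Properties as ℕₚ
  open Lists
  open Partitions

  HookIdentity : List ℕ → (ℕ → Carrier) → Set ℓ
  HookIdentity μ x = rsum x 1 (length μ) ⊛ hookProduct μ x ≈ cornerSum μ (term μ x y)

  topRowTerm : List ℕ → (ℕ → Carrier) → ℕ → Carrier → ℕ × ℕ → Carrier
  topRowTerm μ x a w c = term μ x y c ⊛ hookRowWithout μ x a w (suc a) (proj₂ c)

  TopRowIdentity : List ℕ → (ℕ → Carrier) → ℕ → Set (c ⊔ ℓ)
  TopRowIdentity μ x a = ∀ w →
    hookProduct μ x ⊛ armRow μ x a w ≈ hookProduct μ x ⊛ hookRow μ x a w (suc a) ⊕ cornerSum μ (topRowTerm μ x a w)

  hookIdentity-[] : ∀ x → HookIdentity [] x
  hookIdentity-[] x = trans (zeroˡ 1#) (sym (+-identityʳ 0#))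

  topRow-[] : ∀ x → TopRowIdentity [] x 0
  topRow-[] x w = sym (trans (+-congˡ (+-identityʳ 0#)) (+-identityʳ _))

  -- Lengthening the top row by one cell multiplies both sides by w (after w ↦ w + y_{a+1}).
  topRow-extend : ∀ {μ} → Decreasing μ → ∀ x a → firstPart μ ≤ a → TopRowIdentity μ x a → TopRowIdentity μ x (suc a)
  topRow-extend {μ} d x a μ₁≤a identity w = begin
    Q ⊛ armRow μ x (suc a) w                  ≈⟨ *-congˡ (armRow-extend d x a w μ₁≤a) ⟩
    Q ⊛ (armRow μ x a w' ⊛ w)                 ≈⟨ sym (*-assoc Q _ w) ⟩
    (Q ⊛ armRow μ x a w') ⊛ w                 ≈⟨ *-congʳ (identity w') ⟩
    (Q ⊛ hookRow μ x a w' (suc a) ⊕ S) ⊛ w    ≈⟨ distribʳ w _ _ ⟩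
    (Q ⊛ hookRow μ x a w' (suc a)) ⊛ w ⊕ S ⊛ w
      ≈⟨ +-cong (trans (*-assoc Q _ w) (*-congˡ (sym (hookRow-extend d x a w μ₁≤a)))) (trans (*-comm S w) (sym corners)) ⟩
    Q ⊛ hookRow μ x (suc a) w (suc (suc a)) ⊕ cornerSum μ (topRowTerm μ x (suc a) w) ∎
    where
    Q = hookProduct μ x
    w' = w ⊕ y (suc a)
    S = cornerSum μ (topRowTerm μ x a w')
    corners : cornerSum μ (topRowTerm μ x (suc a) w) ≈ w ⊛ S
    corners = sym (trans (cornerSum-*ˡ μ w (topRowTerm μ x a w')) (cornerSum-cong μ (λ c → w ⊛ topRowTerm μ x a w' c) (topRowTerm μ x (suc a) w) λ i _ →
      trans (solve 3 (λ w t h → w :* (t :* h) := t :* (h :* w)) refl _ _ _)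
            (*-congˡ (sym (hookRowWithout-extend d x a w (suc (part μ i)) μ₁≤a (s≤s (ℕₚ.≤-trans (part-≤-first d i) μ₁≤a)))))))

  topRow-upward : ∀ {μ} → Decreasing μ → ∀ x → TopRowIdentity μ x (firstPart μ) →
                  ∀ a → firstPart μ ≤ a → TopRowIdentity μ x a
  topRow-upward {μ} d x base a μ₁≤a = ≡.subst (TopRowIdentity μ x) (ℕₚ.m+[n∸m]≡n μ₁≤a) (from (a ∸ firstPart μ))
    where
    from : ∀ n → TopRowIdentity μ x (firstPart μ + n)
    from zero    = ≡.subst (TopRowIdentity μ x) (≡.sym (ℕₚ.+-identityʳ (firstPart μ))) base
    from (suc n) = ≡.subst (TopRowIdentity μ x) (≡.sym (ℕₚ.+-suc (firstPart μ) n))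
                           (topRow-extend d x (firstPart μ + n) (ℕₚ.m≤m+n (firstPart μ) n) (from n))

  module Step {b : ℕ} {μ : List ℕ} (d : Decreasing (b ∷ μ)) (1≤b : 1 ≤ b) (x : ℕ → Carrier) where
    open FirstRow R y d x

    private
      dμ = dec-tail d
      μ₁≤b = dec-first d
      x₁ = x 1
      Q = hookProduct μ x'
      -- the hooks of the first row of b ∷ μ off the first column, over μ
      A = hookRow μ x' b x₁ b

    hookRow-cons : ∀ w → hookRow (b ∷ μ) x b w (suc b) ≈ hookRow μ x' b (w ⊕ x₁) b ⊛ w
    hookRow-cons w = trans (hookRow-last d x b w 1≤b ℕₚ.≤-refl)
                           (*-congʳ (hooksOver-cons d x b w (All-range 2 b λ _ _ j≤b → j≤b)))

    hookRowWithout-cons-top : ∀ w → hookRowWithout (b ∷ μ) x b w (suc b) (suc b) ≈ hookRow μ x' b (w ⊕ x₁) b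
    hookRowWithout-cons-top w = trans (prodWithout-last _ b 1≤b) (hooksOver-cons d x b w (All-range 2 b λ _ _ j≤b → j≤b))

    hookRowWithout-cons : ∀ w s → s ≤ b → hookRowWithout (b ∷ μ) x b w (suc b) s ≈ hookRowWithout μ x' b (w ⊕ x₁) b s ⊛ w
    hookRowWithout-cons w s s≤b = trans (hookRowWithout-last d x b w s 1≤b ℕₚ.≤-refl s≤b)
      (*-congʳ (hooksOver-cons d x b w (All-filterB (without s) (All-range 2 b λ _ _ j≤b → j≤b))))

    -- The top-row identity of μ at w = x₁ evaluates the term of the first corner (1, b+1).
    firstCorner : TopRowIdentity μ x' b →
                  term (b ∷ μ) x y (1 , suc b) ≈ Q ⊛ (A ⊛ x₁) ⊕ cornerSum μ (topRowTerm μ x' b x₁)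
    firstCorner topRow = trans term-firstCorner (trans (topRow x₁) (+-congʳ (*-congˡ (hookRow-last dμ x' b x₁ 1≤b μ₁≤b))))

    module LowerCorner (i : ℕ) (ok : cornerRow μ i ≡.≡ true) (s≤b : suc (part μ i) ≤ b) where
      s = suc (part μ i)
      e = topHook μ x' b s

      without-s : Carrier → Carrier
      without-s v = hookRowWithout μ x' b v b s

      row-split : ∀ v → hookRow μ x' b v b ≈ without-s v ⊛ (v ⊕ e)
      row-split v = prod-extract _ b s (s≤s (cornerRow-part μ i ok)) s≤b

      row-last : ∀ v → hookRowWithout μ x' b v (suc b) s ≈ without-s v ⊛ v
      row-last v = hookRowWithout-last dμ x' b v s 1≤b μ₁≤b s≤b

    topRow-corners : ∀ w →
      A ⊛ cornerSum μ (topRowTerm μ x' b (w ⊕ x₁))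
        ≈ hookRow μ x' b (w ⊕ x₁) b ⊛ cornerSum μ (topRowTerm μ x' b x₁) ⊕ lowerSum μ b (topRowTerm (b ∷ μ) x b w)
    topRow-corners w = begin
      A ⊛ cornerSum μ (topRowTerm μ x' b ŵ)              ≈⟨ cornerSum-*ˡ μ A (topRowTerm μ x' b ŵ) ⟩
      cornerSum μ (λ c → A ⊛ topRowTerm μ x' b ŵ c)
        ≈⟨ cornerSum-split d (λ c → A ⊛ topRowTerm μ x' b ŵ c) (λ c → B ⊛ topRowTerm μ x' b x₁ c) (topRowTerm (b ∷ μ) x b w) below top ⟩
      cornerSum μ (λ c → B ⊛ topRowTerm μ x' b x₁ c) ⊕ L ≈⟨ +-congʳ (sym (cornerSum-*ˡ μ B (topRowTerm μ x' b x₁))) ⟩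
      B ⊛ cornerSum μ (topRowTerm μ x' b x₁) ⊕ L         ∎
      where
      ŵ = w ⊕ x₁
      B = hookRow μ x' b ŵ b
      L = lowerSum μ b (topRowTerm (b ∷ μ) x b w)
      -- With G_v the top-row hooks over μ off column s and e the hook of (0, s), we have
      -- A = G_{x₁}(x₁ + e), and the claim reduces to (x₁ + e)(w + x₁) = (w + x₁ + e) x₁ + e w.
      below : ∀ i → cornerRow μ i ≡.≡ true → suc (part μ i) ≤ b →
              A ⊛ topRowTerm μ x' b ŵ (i , suc (part μ i))
                ≈ B ⊛ topRowTerm μ x' b x₁ (i , suc (part μ i)) ⊕ topRowTerm (b ∷ μ) x b w (suc i , suc (part μ i))
      below i ok s≤b = begin
        A ⊛ (T ⊛ hookRowWithout μ x' b ŵ (suc b) s)   ≈⟨ *-cong (row-split x₁) (*-congˡ (row-last ŵ)) ⟩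
        (without-s x₁ ⊛ (x₁ ⊕ e)) ⊛ (T ⊛ (without-s ŵ ⊛ ŵ))
          ≈⟨ solve 6 (λ G₁ G T w x₁ e → (G₁ :* (x₁ :+ e)) :* (T :* (G :* (w :+ x₁)))
                        := (G :* ((w :+ x₁) :+ e)) :* (T :* (G₁ :* x₁)) :+ ((T :* G₁) :* e) :* (G :* w))
                     refl (without-s x₁) (without-s ŵ) T w x₁ e ⟩
        (without-s ŵ ⊛ (ŵ ⊕ e)) ⊛ (T ⊛ (without-s x₁ ⊛ x₁)) ⊕ ((T ⊛ without-s x₁) ⊛ e) ⊛ (without-s ŵ ⊛ w)
          ≈⟨ sym (+-cong (*-cong (row-split ŵ) (*-congˡ (row-last x₁)))
                         (*-cong (term-lowerCorner i ok s≤b) (hookRowWithout-cons w s s≤b))) ⟩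
        B ⊛ (T ⊛ hookRowWithout μ x' b x₁ (suc b) s) ⊕ term (b ∷ μ) x y (suc i , s) ⊛ hookRowWithout (b ∷ μ) x b w (suc b) s ∎
        where
        open LowerCorner i ok s≤b
        T = term μ x' y (i , s)
      top : ∀ i → A ⊛ topRowTerm μ x' b ŵ (i , suc b) ≈ B ⊛ topRowTerm μ x' b x₁ (i , suc b)
      top i = trans (*-congˡ (*-congˡ (prodWithout-last _ b 1≤b)))
        (trans (solve 3 (λ A B T → A :* (T :* B) := B :* (T :* A)) refl A B (term μ x' y (i , suc b)))
               (sym (*-congˡ (*-congˡ (prodWithout-last _ b 1≤b)))))

    hook-corners : A ⊛ cornerSum μ (term μ x' y) ≈ cornerSum μ (topRowTerm μ x' b x₁) ⊕ lowerSum μ b (term (b ∷ μ) x y)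
    hook-corners = trans (cornerSum-*ˡ μ A (term μ x' y))
                         (cornerSum-split d (λ c → A ⊛ term μ x' y c) (topRowTerm μ x' b x₁) (term (b ∷ μ) x y) below top)
      where
      below : ∀ i → cornerRow μ i ≡.≡ true → suc (part μ i) ≤ b →
              A ⊛ term μ x' y (i , suc (part μ i)) ≈ topRowTerm μ x' b x₁ (i , suc (part μ i)) ⊕ term (b ∷ μ) x y (suc i , suc (part μ i))
      below i ok s≤b = begin
        A ⊛ T                                  ≈⟨ *-congʳ (row-split x₁) ⟩
        (without-s x₁ ⊛ (x₁ ⊕ e)) ⊛ T          ≈⟨ solve 4 (λ G T x₁ e → (G :* (x₁ :+ e)) :* T := T :* (G :* x₁) :+ (T :* G) :* e)
                                                         refl (without-s x₁) T x₁ e ⟩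
        T ⊛ (without-s x₁ ⊛ x₁) ⊕ (T ⊛ without-s x₁) ⊛ e
          ≈⟨ sym (+-cong (*-congˡ (row-last x₁)) (term-lowerCorner i ok s≤b)) ⟩
        T ⊛ hookRowWithout μ x' b x₁ (suc b) s ⊕ term (b ∷ μ) x y (suc i , s) ∎
        where
        open LowerCorner i ok s≤b
        T = term μ x' y (i , s)
      top : ∀ i → A ⊛ term μ x' y (i , suc b) ≈ topRowTerm μ x' b x₁ (i , suc b)
      top i = trans (*-comm A _) (*-congˡ (sym (prodWithout-last _ b 1≤b)))

    topRow-step : TopRowIdentity μ x' b → TopRowIdentity (b ∷ μ) x b
    topRow-step topRow w = begin
      hookProduct (b ∷ μ) x ⊛ armRow (b ∷ μ) x b w      ≈⟨ *-cong (hookProduct-cons 1≤b) (armRow-cons d x b w ℕₚ.≤-refl) ⟩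
      (A ⊛ Q) ⊛ armRow μ x' b ŵ                          ≈⟨ *-assoc A Q _ ⟩
      A ⊛ (Q ⊛ armRow μ x' b ŵ)                          ≈⟨ *-congˡ (topRow ŵ) ⟩
      A ⊛ (Q ⊛ hookRow μ x' b ŵ (suc b) ⊕ Sŵ)            ≈⟨ *-congˡ (+-congʳ (*-congˡ (hookRow-last dμ x' b ŵ 1≤b μ₁≤b))) ⟩
      A ⊛ (Q ⊛ (B ⊛ ŵ) ⊕ Sŵ)                             ≈⟨ distribˡ A _ _ ⟩
      A ⊛ (Q ⊛ (B ⊛ ŵ)) ⊕ A ⊛ Sŵ                         ≈⟨ +-congˡ (topRow-corners w) ⟩
      A ⊛ (Q ⊛ (B ⊛ ŵ)) ⊕ (B ⊛ S₁ ⊕ L)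
        ≈⟨ solve 7 (λ A B Q w x₁ S₁ L → A :* (Q :* (B :* (w :+ x₁))) :+ (B :* S₁ :+ L)
                      := (A :* Q) :* (B :* w) :+ ((Q :* (A :* x₁) :+ S₁) :* B :+ L)) refl A B Q w x₁ S₁ L ⟩
      (A ⊛ Q) ⊛ (B ⊛ w) ⊕ ((Q ⊛ (A ⊛ x₁) ⊕ S₁) ⊛ B ⊕ L)
        ≈⟨ sym (+-cong (*-cong (hookProduct-cons 1≤b) (hookRow-cons w))
                       (trans (cornerSum-cons d 1≤b (topRowTerm (b ∷ μ) x b w))
                              (+-congʳ (*-cong (firstCorner topRow) (hookRowWithout-cons-top w))))) ⟩
      hookProduct (b ∷ μ) x ⊛ hookRow (b ∷ μ) x b w (suc b) ⊕ cornerSum (b ∷ μ) (topRowTerm (b ∷ μ) x b w) ∎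
      where
      ŵ = w ⊕ x₁
      B = hookRow μ x' b ŵ b
      Sŵ = cornerSum μ (topRowTerm μ x' b ŵ)
      S₁ = cornerSum μ (topRowTerm μ x' b x₁)
      L = lowerSum μ b (topRowTerm (b ∷ μ) x b w)

    hookIdentity-step : HookIdentity μ x' → TopRowIdentity μ x' b → HookIdentity (b ∷ μ) x
    hookIdentity-step hook topRow = begin
      rsum x 1 (suc (length μ)) ⊛ hookProduct (b ∷ μ) x   ≈⟨ *-cong (rsum-from-1 x (length μ)) (hookProduct-cons 1≤b) ⟩
      (x₁ ⊕ X) ⊛ (A ⊛ Q)                                  ≈⟨ solve 4 (λ x₁ X A Q → (x₁ :+ X) :* (A :* Q) := x₁ :* (A :* Q) :+ A :* (X :* Q))
                                                                     refl x₁ X A Q ⟩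
      x₁ ⊛ (A ⊛ Q) ⊕ A ⊛ (X ⊛ Q)                           ≈⟨ +-congˡ (*-congˡ hook) ⟩
      x₁ ⊛ (A ⊛ Q) ⊕ A ⊛ cornerSum μ (term μ x' y)         ≈⟨ +-congˡ hook-corners ⟩
      x₁ ⊛ (A ⊛ Q) ⊕ (S₁ ⊕ L)                              ≈⟨ solve 5 (λ x₁ A Q S₁ L → x₁ :* (A :* Q) :+ (S₁ :+ L) := (Q :* (A :* x₁) :+ S₁) :+ L)
                                                                     refl x₁ A Q S₁ L ⟩
      (Q ⊛ (A ⊛ x₁) ⊕ S₁) ⊕ L                              ≈⟨ sym (trans (cornerSum-cons d 1≤b (term (b ∷ μ) x y)) (+-congʳ (firstCorner topRow))) ⟩
      cornerSum (b ∷ μ) (term (b ∷ μ) x y)                 ∎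
      where
      X = rsum x' 1 (length μ)
      S₁ = cornerSum μ (topRowTerm μ x' b x₁)
      L = lowerSum μ b (term (b ∷ μ) x y)

  partition-identities : ∀ μ → IsPartition μ → ∀ x → HookIdentity μ x × TopRowIdentity μ x (firstPart μ)
  partition-identities []      _                    x = hookIdentity-[] x , topRow-[] x
  partition-identities (b ∷ μ) (d , pos-∷ 1≤b μ⁺) x = hookIdentity-step (proj₁ forμ) topRowᵇ , topRow-step topRowᵇ
    where
    open Step d 1≤b x
    forμ : HookIdentity μ (dropFirst x) × TopRowIdentity μ (dropFirst x) (firstPart μ)
    forμ = partition-identities μ (dec-tail d , μ⁺) (dropFirst x)
    topRowᵇ : TopRowIdentity μ (dropFirst x) b
    topRowᵇ = topRow-upward (dec-tail d) (dropFirst x) (proj₂ forμ) b (dec-first d)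

mainTheorem2 : ∀ {c ℓ : Level} (R : CommutativeRing c ℓ) (λs : List ℕ) → IsPartition λs →
    (x y : ℕ → CommutativeRing.Carrier R) →
    CommutativeRing._≈_ R (RingSums.LHS R λs x y) (RingSums.RHS R λs x y)
mainTheorem2 R λs partition x y =
  trans (proj₁ (partition-identities λs partition x)) (sym (corners-by-row λs (proj₁ partition) (RingSums.term R λs x y)))
  where
  open CommutativeRing R using (trans; sym)
  open RingLists R
  open Identities R y
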